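{- Let $M=(m_{i,j})$ be an $n\times n$ optimal binary matrix ($1\le i,j\le n$). Then each of the following matrices is also optimal: (i) $M_\pi=(m_{\pi(i),j})$ for any permutation $\pi$ of $\{1,\dots,n\}$; (ii) $M_r=(m_{i,n-j+1})$; (iii) $\overline{M}=(\overline{m}_{i,j})$, where $\overline{m}_{i,j}=1-m_{i,j}$.
   Context: Biker–hiker model: $n$ travellers $t_1,\dots,t_n$; posts $P_0,\dots,P_n$ at unit spacing; stage $s_j$ is the leg from $P_{j-1}$ to $P_j$. All start at $P_0$ at time $0$, walk at common speed $w$, cycle at common speed $v>w$, mode changes take no time. The $n\times n$ binary matrix $M=(m_{i,j})$ prescribes that $t_i$ cycles $s_j$ iff $m_{i,j}=1$. $M$ is $k$-uniform if every row and every column has exactly $k$ ones. Bicycles start at $P_0$, move only when ridden by one rider, and a traveller due to cycle $s_j$ must take a bicycle present at $P_{j-1}$ when he arrives there. $M$ is optimal if it is $k$-uniform for some $k$ and, with $k$ bicycles, the scheme can be executed with no traveller ever having to wait for a bicycle.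
   Formalization: The cycling speed $v$ and the walking speed $w$ are rational. -}

module Defs where

open import Data.Nat using (ℕ; zero; suc; _+_; _∸_; _<ᵇ_)
open import Data.Bool using (Bool; true; false; if_then_else_; _∧_)
open import Data.Fin using (Fin; toℕ)
import Data.Fin as F
open import Data.Integer using (+_)
open import Data.Rational using (ℚ; _/_; _≤_) renaming (_+_ to _+ℚ_; _*_ to _*ℚ_)
open import Data.Product using (Σ; _×_; ∃)
open import Relation.Binary.PropositionalEquality using (_≡_)

-- An n×n binary matrix: M i j = m_{i,j}; row i = traveller t_{i+1},
-- column j = stage s_{j+1} (0-indexed via Fin n).
Matrix : ℕ → Set
Matrix n = Fin n → Fin n → Bool

count : ∀ {n} → (Fin n → Bool) → ℕ
count {zero}  f = 0
count {suc n} f = (if f F.zero then 1 else 0) + count (λ x → f (F.suc x))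

Uniform : ∀ {n} → Matrix n → ℕ → Set
Uniform {n} M k = (∀ i → count (λ j → M i j) ≡ k) × (∀ j → count (λ i → M i j) ≡ k)

ℕtoℚ : ℕ → ℚ
ℕtoℚ c = (+ c) / 1

cycledUpTo : ∀ {n} → (Fin n → Bool) → ℕ → ℕ
cycledUpTo r p = count (λ s → r s ∧ (toℕ s <ᵇ p))

-- Arrival time of traveller i at post P_p when nobody waits,
-- where a = 1/v (time to cycle one stage), b = 1/w (time to walk one stage).
arrival : ∀ {n} → ℚ → ℚ → Matrix n → Fin n → ℕ → ℚ
arrival a b M i p =
  (ℕtoℚ (cycledUpTo (M i) p) *ℚ a) +ℚ (ℕtoℚ (p ∸ cycledUpTo (M i) p) *ℚ b)

-- The scheme M can be executed with k bicycles (all initially at P_0)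
-- without anyone waiting.  bike i j h is the bicycle that t_i rides on
-- stage j (only defined when m_{i,j} = 1).
--  * a bicycle carries one rider and, once ridden along stage j, is at the
--    end of stage j and can never come back, so it is ridden on each stage
--    at most once (injectivity per column);
--  * a bicycle ridden on stage j (not the first) must have been brought to
--    the start post P_j of that stage by a rider of the previous stage,
--    arriving there no later than the new rider arrives there.
Executable : ℚ → ℚ → ∀ {n} → Matrix n → ℕ → Set
Executable a b {n} M k =
  Σ ((i j : Fin n) → M i j ≡ true → Fin k) λ bike →
    (∀ j i i' (h : M i j ≡ true) (h' : M i' j ≡ true) →
       bike i j h ≡ bike i' j h' → i ≡ i')
    ×
    (∀ (j j' : Fin n) → toℕ j ≡ suc (toℕ j') →
       ∀ i (h : M i j ≡ true) →
       Σ (Fin n) λ i' → Σ (M i' j' ≡ true) λ h' →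
         (bike i' j' h' ≡ bike i j h)
         × (arrival a b M i' (toℕ j) ≤ arrival a b M i (toℕ j)))

Optimal : ℚ → ℚ → ∀ {n} → Matrix n → Set
Optimal a b M = ∃ λ k → Uniform M k × Executable a b M k

{-# OPTIONS --safe #-}

-- Once every column has k ones, executability with k bicycles is the same as a
-- handover: for consecutive stages j' → j, an injection from the riders of j into
-- the riders of j' that only hands over bicycles from riders arriving no later at
-- the common post (bicycles are then named by the first-stage rider they start with).
-- Permuting travellers transports handovers.  For the reversal, a row's arrival at
-- post p after reversing and its arrival at post n − p before add up to a constant,
-- so inverting the handover of the mirrored pair of stages (a bijection, as all
-- columns have k ones) turns "no later" into "no later" again.  For the complement,
-- start from a non-rider of j' and follow the handover while it stays among the
-- riders of j: this injects the non-riders of j' into the non-riders of j without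
-- increasing arrivals, and its inverse is a handover of the complement, because a
-- row's arrivals at a post in M and in its complement also have a constant sum.
-- Nothing about the speeds a and b is used.

module Submission where

open import Defs
open import Data.Nat as ℕ using (ℕ; zero; suc; _+_; _∸_; _≤_; _<_; z≤n; s≤s; s≤s⁻¹; _<ᵇ_)
open import Data.Nat.Properties
  using (≤-refl; ≤-trans; ≤-reflexive; ≤-antisym; ≤-total; <-trans; <⇒≤; <⇒≢; ≤⇒≯; <-irrefl
        ; +-mono-≤; +-mono-≤-<; +-comm; +-suc; +-identityʳ; m≤m+n; m∸n≤m; n≤1+n
        ; m+n∸m≡n; m+[n∸m]≡n; +-∸-assoc; +-∸-comm; ∸-+-assoc; <ᵇ⇒<; <⇒<ᵇ)
import Data.Nat.Properties as ℕP
open import Data.Nat.GeneralisedArithmetic using (iterate; iterate-is-fold)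
open import Data.Bool using (Bool; true; false; if_then_else_; _∧_; not)
open import Data.Bool.Properties using (∧-zeroʳ; ∧-identityʳ; ∧-comm; T-≡)
import Data.Bool.Properties as BoolP
open import Data.Fin as F using (Fin; toℕ; opposite; fromℕ<)
import Data.Fin.Properties as FP
open import Data.Fin.Permutation using (Permutation′; _⟨$⟩ʳ_; _⟨$⟩ˡ_; inverseˡ; inverseʳ; reverse)
open import Data.Integer as ℤ using (+_)
import Data.Integer.Properties as ℤP
open import Data.Rational using (ℚ; 0ℚ; toℚᵘ) renaming (_+_ to _+ℚ_; _*_ to _*ℚ_; -_ to -ℚ_; _≤_ to _≤ℚ_; _<_ to _<ℚ_)
import Data.Rational.Properties as ℚP
import Data.Rational.Unnormalised as ℚᵘ
import Data.Rational.Unnormalised.Properties as ℚᵘP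
open import Data.Rational.Solver using (module +-*-Solver)
open import Data.Product using (Σ; ∃; _×_; _,_; proj₁; proj₂)
open import Data.Sum using (inj₁; inj₂)
open import Function using (_∘_; flip; Equivalence)
open import Relation.Binary.Definitions using (Reflexive; Transitive; tri<; tri≈; tri>)
open import Relation.Nullary using (¬_; yes; no; does; contradiction)
open import Relation.Nullary.Decidable using (_×-dec_)
open import Relation.Binary.PropositionalEquality
open import Axiom.UniquenessOfIdentityProofs using (module Decidable⇒UIP)

private
  variable
    m n k : ℕ

-- Counting

_⊆_ : (Fin n → Bool) → (Fin n → Bool) → Set
A ⊆ B = ∀ x → A x ≡ true → B x ≡ true

indicator : Bool → ℕ
indicator b = if b then 1 else 0

count-cong : {A B : Fin n → Bool} → (∀ x → A x ≡ B x) → count A ≡ count B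
count-cong {zero}  _   = refl
count-cong {suc n} A≗B = cong₂ _+_ (cong indicator (A≗B F.zero)) (count-cong (A≗B ∘ F.suc))

indicator-mono : {a b : Bool} → (a ≡ true → b ≡ true) → indicator a ≤ indicator b
indicator-mono {false} _   = z≤n
indicator-mono {true}  a⇒b rewrite a⇒b refl = ≤-refl

count-mono : {A B : Fin n → Bool} → A ⊆ B → count A ≤ count B
count-mono {zero}  _   = z≤n
count-mono {suc n} A⊆B = +-mono-≤ (indicator-mono (A⊆B F.zero)) (count-mono (A⊆B ∘ F.suc))

count-mono-< : {A B : Fin n → Bool} → A ⊆ B → ∀ y → A y ≡ false → B y ≡ true → count A < count B
count-mono-< {suc n} A⊆B F.zero Ay By rewrite Ay | By = s≤s (count-mono (A⊆B ∘ F.suc))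
count-mono-< {suc n} A⊆B (F.suc y) Ay By =
  +-mono-≤-< (indicator-mono (A⊆B F.zero)) (count-mono-< (A⊆B ∘ F.suc) y Ay By)

remove : (Fin n → Bool) → Fin n → Fin n → Bool
remove B y z = B z ∧ not (does (z FP.≟ y))

remove-⊆ : (B : Fin n → Bool) (y : Fin n) → remove B y ⊆ B
remove-⊆ B y z _ with B z
... | true = refl

remove-keeps : (B : Fin n → Bool) {y z : Fin n} → B z ≡ true → z ≢ y → remove B y z ≡ true
remove-keeps B {y} {z} Bz z≢y with z FP.≟ y
... | yes z≡y = contradiction z≡y z≢y
... | no  _   rewrite Bz = refl

count-remove : (B : Fin n → Bool) {y : Fin n} → B y ≡ true → count (remove B y) < count B
count-remove B {y} By = count-mono-< (remove-⊆ B y) y removed By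
  where
  removed : remove B y y ≡ false
  removed with y FP.≟ y
  ... | yes _   = ∧-zeroʳ (B y)
  ... | no  y≢y = contradiction refl y≢y

mutual
  count-≤-injection : {A : Fin m → Bool} {B : Fin n → Bool} (f : Fin m → Fin n) →
    (∀ x → A x ≡ true → B (f x) ≡ true) →
    (∀ x y → A x ≡ true → A y ≡ true → f x ≡ f y → x ≡ y) →
    count A ≤ count B
  count-≤-injection {zero} f _ _ = z≤n
  count-≤-injection {suc m} {A = A} f into inj with A F.zero in A0
  ... | false = count-≤-injection (f ∘ F.suc) (into ∘ F.suc)
                  (λ x y Ax Ay eq → FP.suc-injective (inj (F.suc x) (F.suc y) Ax Ay eq))
  ... | true  = count-<-injection (f ∘ F.suc) (into ∘ F.suc)
                  (λ x y Ax Ay eq → FP.suc-injective (inj (F.suc x) (F.suc y) Ax Ay eq))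
                  (into F.zero A0) (λ x Ax eq → 0≢suc (inj F.zero (F.suc x) A0 Ax (sym eq)))
    where
    0≢suc : ∀ {x : Fin m} → F.zero ≢ F.suc x
    0≢suc ()

  count-<-injection : {A : Fin m → Bool} {B : Fin n → Bool} (f : Fin m → Fin n) →
    (∀ x → A x ≡ true → B (f x) ≡ true) →
    (∀ x y → A x ≡ true → A y ≡ true → f x ≡ f y → x ≡ y) →
    ∀ {y} → B y ≡ true → (∀ x → A x ≡ true → f x ≢ y) → count A < count B
  count-<-injection {B = B} f into inj By missed =
    ≤-trans (s≤s (count-≤-injection f (λ x Ax → remove-keeps B (into x Ax) (missed x Ax)) inj))
            (count-remove B By)

count-permute : (π : Permutation′ n) (A : Fin n → Bool) → count (λ x → A (π ⟨$⟩ʳ x)) ≡ count A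
count-permute π A = ≤-antisym
  (count-≤-injection (π ⟨$⟩ʳ_) (λ _ Ax → Ax)
    (λ x y _ _ eq → trans (sym (inverseˡ π)) (trans (cong (π ⟨$⟩ˡ_) eq) (inverseˡ π))))
  (count-≤-injection (π ⟨$⟩ˡ_) (λ x Ax → subst (λ z → A z ≡ true) (sym (inverseʳ π)) Ax)
    (λ x y _ _ eq → trans (sym (inverseʳ π)) (trans (cong (π ⟨$⟩ʳ_) eq) (inverseʳ π))))

count-partition : (A B : Fin n → Bool) →
  count B ≡ count (λ x → A x ∧ B x) + count (λ x → not (A x) ∧ B x)
count-partition {zero}  A B = refl
count-partition {suc n} A B with A F.zero | B F.zero
... | true  | true  = cong suc (count-partition (A ∘ F.suc) (B ∘ F.suc))
... | true  | false = count-partition (A ∘ F.suc) (B ∘ F.suc)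
... | false | true  = trans (cong suc (count-partition (A ∘ F.suc) (B ∘ F.suc))) (sym (+-suc _ _))
... | false | false = count-partition (A ∘ F.suc) (B ∘ F.suc)

count-const-true : ∀ n → count {n} (λ _ → true) ≡ n
count-const-true zero    = refl
count-const-true (suc n) = cong suc (count-const-true n)

count-const-false : ∀ n → count {n} (λ _ → false) ≡ 0
count-const-false zero    = refl
count-const-false (suc n) = count-const-false n

count-not : (A : Fin n → Bool) → count (λ x → not (A x)) ≡ n ∸ count A
count-not {n} A = begin
  count (not ∘ A)                   ≡⟨ sym (m+n∸m≡n (count A) _) ⟩
  (count A + count (not ∘ A)) ∸ count A ≡⟨ cong (_∸ count A) (sym everyone) ⟩
  n ∸ count A                       ∎
  where
  open ≡-Reasoning
  everyone : n ≡ count A + count (not ∘ A)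
  everyone = trans (sym (count-const-true n)) (trans (count-partition A (λ _ → true))
    (cong₂ _+_ (count-cong (∧-identityʳ ∘ A)) (count-cong (∧-identityʳ ∘ not ∘ A))))

<⇒<ᵇ≡true : ∀ {m n} → m < n → (m <ᵇ n) ≡ true
<⇒<ᵇ≡true m<n = Equivalence.to T-≡ (<⇒<ᵇ m<n)

<ᵇ≡true⇒< : ∀ {m n} → (m <ᵇ n) ≡ true → m < n
<ᵇ≡true⇒< {m} {n} m<ᵇn = <ᵇ⇒< m n (Equivalence.from T-≡ m<ᵇn)

≮⇒<ᵇ≡false : ∀ {m n} → ¬ m < n → (m <ᵇ n) ≡ false
≮⇒<ᵇ≡false {m} {n} m≮n with m <ᵇ n in m<ᵇn
... | true  = contradiction (<ᵇ≡true⇒< m<ᵇn) m≮n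
... | false = refl

rank : (Fin n → Bool) → Fin n → ℕ
rank A x = count (λ y → A y ∧ (toℕ y <ᵇ toℕ x))

not-before-itself : (A : Fin n → Bool) (x : Fin n) → (A x ∧ (toℕ x <ᵇ toℕ x)) ≡ false
not-before-itself A x rewrite ≮⇒<ᵇ≡false (<-irrefl (refl {x = toℕ x})) = ∧-zeroʳ (A x)

∧-true-left : ∀ {a b} → a ∧ b ≡ true → a ≡ true
∧-true-left {true} _ = refl

∧-true-right : ∀ {a b} → a ∧ b ≡ true → b ≡ true
∧-true-right {true} b≡true = b≡true

rank<count : (A : Fin n → Bool) {x : Fin n} → A x ≡ true → rank A x < count A
rank<count A {x} Ax = count-mono-< (λ _ → ∧-true-left) x (not-before-itself A x) Ax

rank-mono : (A : Fin n → Bool) {x y : Fin n} → A x ≡ true → toℕ x < toℕ y → rank A x < rank A y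
rank-mono A {x} {y} Ax x<y = count-mono-< earlier x (not-before-itself A x)
  (cong₂ _∧_ Ax (<⇒<ᵇ≡true x<y))
  where
  earlier : (λ z → A z ∧ (toℕ z <ᵇ toℕ x)) ⊆ (λ z → A z ∧ (toℕ z <ᵇ toℕ y))
  earlier z before-x = cong₂ _∧_ (∧-true-left before-x)
    (<⇒<ᵇ≡true (<-trans (<ᵇ≡true⇒< (∧-true-right before-x)) x<y))

rank-injective : (A : Fin n → Bool) {x y : Fin n} → A x ≡ true → A y ≡ true → rank A x ≡ rank A y → x ≡ y
rank-injective A {x} {y} Ax Ay same with FP.<-cmp x y
... | tri< x<y _ _ = contradiction same (<⇒≢ (rank-mono A Ax x<y))
... | tri≈ _ x≡y _ = x≡y
... | tri> _ _ y<x = contradiction (sym same) (<⇒≢ (rank-mono A Ay y<x))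

count-before≤ : ∀ n p → count {n} (λ s → toℕ s <ᵇ p) ≤ p
count-before≤ zero    p       = z≤n
count-before≤ (suc n) zero    = ≤-reflexive (count-const-false n)
count-before≤ (suc n) (suc p) = s≤s (count-before≤ n p)

-- Arrival times

cycledUpTo≤ : (r : Fin n → Bool) (p : ℕ) → cycledUpTo r p ≤ p
cycledUpTo≤ {n} r p = ≤-trans (count-mono {A = λ s → r s ∧ (toℕ s <ᵇ p)} (λ _ → ∧-true-right)) (count-before≤ n p)

ℕtoℚ-+ : ∀ x y → ℕtoℚ (x + y) ≡ ℕtoℚ x +ℚ ℕtoℚ y
ℕtoℚ-+ x y = ℚP.toℚᵘ-injective (begin
  toℚᵘ (ℕtoℚ (x + y))                   ≈⟨ ℚP.toℚᵘ-fromℚᵘ (ℚᵘ.mkℚᵘ (+ (x + y)) 0) ⟩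
  ℚᵘ.mkℚᵘ (+ (x + y)) 0                  ≈⟨ ℚᵘ.*≡* integer-sum ⟩
  ℚᵘ.mkℚᵘ (+ x) 0 ℚᵘ.+ ℚᵘ.mkℚᵘ (+ y) 0  ≈⟨ ℚᵘP.+-cong (ℚᵘP.≃-sym (ℚP.toℚᵘ-fromℚᵘ (ℚᵘ.mkℚᵘ (+ x) 0)))
                                                    (ℚᵘP.≃-sym (ℚP.toℚᵘ-fromℚᵘ (ℚᵘ.mkℚᵘ (+ y) 0))) ⟩
  toℚᵘ (ℕtoℚ x) ℚᵘ.+ toℚᵘ (ℕtoℚ y)     ≈⟨ ℚᵘP.≃-sym (ℚP.toℚᵘ-homo-+ (ℕtoℚ x) (ℕtoℚ y)) ⟩
  toℚᵘ (ℕtoℚ x +ℚ ℕtoℚ y)              ∎)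
  where
  open import Relation.Binary.Reasoning.Setoid ℚᵘP.≃-setoid
  integer-sum : + (x + y) ℤ.* + 1 ≡ (+ x ℤ.* + 1 ℤ.+ + y ℤ.* + 1) ℤ.* + 1
  integer-sum = cong (ℤ._* + 1) (trans (ℤP.pos-+ x y)
    (sym (cong₂ ℤ._+_ (ℤP.*-identityʳ (+ x)) (ℤP.*-identityʳ (+ y)))))

-- arrival a b M x p unfolds to travelTime a b (cycledUpTo (M x) p) p.
travelTime : ℚ → ℚ → ℕ → ℕ → ℚ
travelTime a b c p = ℕtoℚ c *ℚ a +ℚ ℕtoℚ (p ∸ c) *ℚ b

∸-+-distrib : ∀ {c c' p p'} → c ≤ p → c' ≤ p' → (p + p') ∸ (c + c') ≡ (p ∸ c) + (p' ∸ c')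
∸-+-distrib {c} {c'} {p} {p'} c≤p c'≤p' = begin
  (p + p') ∸ (c + c') ≡⟨ sym (∸-+-assoc (p + p') c c') ⟩
  ((p + p') ∸ c) ∸ c' ≡⟨ cong (_∸ c') (+-∸-comm p' c≤p) ⟩
  ((p ∸ c) + p') ∸ c' ≡⟨ +-∸-assoc (p ∸ c) c'≤p' ⟩
  (p ∸ c) + (p' ∸ c') ∎
  where open ≡-Reasoning

travelTime-+ : ∀ a b {c c' p p'} → c ≤ p → c' ≤ p' →
  travelTime a b c p +ℚ travelTime a b c' p' ≡ travelTime a b (c + c') (p + p')
travelTime-+ a b {c} {c'} {p} {p'} c≤p c'≤p'
  rewrite ∸-+-distrib c≤p c'≤p' | ℕtoℚ-+ c c' | ℕtoℚ-+ (p ∸ c) (p' ∸ c') =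
  solve 6 (λ a b c c' w w' → (c :* a :+ w :* b) :+ (c' :* a :+ w' :* b)
                          := (c :+ c') :* a :+ (w :+ w') :* b)
        refl a b (ℕtoℚ c) (ℕtoℚ c') (ℕtoℚ (p ∸ c)) (ℕtoℚ (p' ∸ c'))
  where open +-*-Solver

arrivals-sum : ∀ a b {M M' : Matrix n} x x' p p' {c} → cycledUpTo (M x) p + cycledUpTo (M' x') p' ≡ c →
  arrival a b M x p +ℚ arrival a b M' x' p' ≡ travelTime a b c (p + p')
arrivals-sum a b {M} {M'} x x' p p' refl = travelTime-+ a b (cycledUpTo≤ (M x) p) (cycledUpTo≤ (M' x') p')

swap-≤ : ∀ {u v u' v'} → u +ℚ v ≡ u' +ℚ v' → v' ≤ℚ v → u ≤ℚ u'
swap-≤ {u} {v} {u'} {v'} sums v'≤v = begin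
  u                  ≡⟨ solve 2 (λ u v → u := (u :+ v) :+ :- v) refl u v' ⟩
  (u +ℚ v') +ℚ -ℚ v' ≤⟨ ℚP.+-monoˡ-≤ (-ℚ v') (ℚP.+-monoʳ-≤ u v'≤v) ⟩
  (u +ℚ v) +ℚ -ℚ v'  ≡⟨ cong (_+ℚ -ℚ v') sums ⟩
  (u' +ℚ v') +ℚ -ℚ v' ≡⟨ solve 2 (λ u v → (u :+ v) :+ :- v := u) refl u' v' ⟩
  u'                 ∎
  where
  open ℚP.≤-Reasoning
  open +-*-Solver

Earlier : ℚ → ℚ → Matrix n → ℕ → Fin n → Fin n → Set
Earlier a b M p x y = arrival a b M x p ≤ℚ arrival a b M y p

Earlier-antitone : ∀ {a b} {M M' : Matrix n} {p q} (T : ℚ) →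
  (∀ x → arrival a b M' x p +ℚ arrival a b M x q ≡ T) →
  ∀ {x y} → Earlier a b M q y x → Earlier a b M' p x y
Earlier-antitone T sum {x} {y} = swap-≤ (trans (sum x) (sym (sum y)))

-- Injections that do not increase a relation

record Injects (R : Fin n → Fin n → Set) (A B : Fin n → Bool) (f : Fin n → Fin n) : Set where
  field
    maps-into : ∀ x → A x ≡ true → B (f x) ≡ true
    injective : ∀ x y → A x ≡ true → A y ≡ true → f x ≡ f y → x ≡ y
    related   : ∀ x → A x ≡ true → R (f x) x

open Injects

Injects-weaken : ∀ {R S : Fin n → Fin n → Set} {A B f} →
  (∀ {x y} → R x y → S x y) → Injects R A B f → Injects S A B f
Injects-weaken R⇒S I = record
  { maps-into = maps-into I
  ; injective = injective I
  ; related   = λ x Ax → R⇒S (related I x Ax)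
  }

Injects-reindex : ∀ {R A B f} (π : Permutation′ n) → Injects R A B f →
  Injects (λ x y → R (π ⟨$⟩ʳ x) (π ⟨$⟩ʳ y)) (λ x → A (π ⟨$⟩ʳ x)) (λ x → B (π ⟨$⟩ʳ x))
          (λ x → π ⟨$⟩ˡ f (π ⟨$⟩ʳ x))
Injects-reindex {R = R} {A} {B} {f} π I = record
  { maps-into = λ x Ax → subst (λ z → B z ≡ true) (sym (inverseʳ π)) (maps-into I _ Ax)
  ; injective = λ x y Ax Ay eq → trans (sym (inverseˡ π)) (trans (cong (π ⟨$⟩ˡ_)
      (injective I _ _ Ax Ay (trans (sym (inverseʳ π)) (trans (cong (π ⟨$⟩ʳ_) eq) (inverseʳ π)))))
      (inverseˡ π))
  ; related   = λ x Ax → subst (λ z → R z (π ⟨$⟩ʳ x)) (sym (inverseʳ π)) (related I _ Ax)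
  }

-- The junk value y is returned when y has no preimage in A.
preimage : (Fin n → Bool) → (Fin n → Fin n) → Fin n → Fin n
preimage A f y with FP.any? (λ x → (A x BoolP.≟ true) ×-dec (f x FP.≟ y))
... | yes (x , _) = x
... | no  _       = y

preimage-spec : {R : Fin n → Fin n → Set} {A B : Fin n → Bool} {f : Fin n → Fin n} → Injects R A B f → count B ≤ count A →
  ∀ y → B y ≡ true → A (preimage A f y) ≡ true × f (preimage A f y) ≡ y
preimage-spec {A = A} {B} {f} I B≤A y By with FP.any? (λ x → (A x BoolP.≟ true) ×-dec (f x FP.≟ y))
... | yes (_ , hit) = hit
... | no  missed    = contradiction B≤A (ℕP.<⇒≱
      (count-<-injection f (maps-into I) (injective I) By (λ x Ax fx≡y → missed (x , Ax , fx≡y))))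

Injects-inverse : {R : Fin n → Fin n → Set} {A B : Fin n → Bool} {f : Fin n → Fin n} → count B ≤ count A → Injects R A B f →
  Injects (flip R) B A (preimage A f)
Injects-inverse {R = R} {A = A} {f = f} B≤A I = record
  { maps-into = λ y By → proj₁ (spec y By)
  ; injective = λ y y' By By' eq →
      trans (sym (proj₂ (spec y By))) (trans (cong f eq) (proj₂ (spec y' By')))
  ; related   = λ y By →
      subst (λ z → R z (preimage A f y)) (proj₂ (spec y By)) (related I _ (proj₁ (spec y By)))
  }
  where spec = preimage-spec I B≤A

not≡true⇒≡false : ∀ {b} → not b ≡ true → b ≡ false
not≡true⇒≡false {false} _ = refl

≡false⇒not≡true : ∀ {b} → b ≡ false → not b ≡ true
≡false⇒not≡true refl = refl

Run : (Fin n → Bool) → (Fin n → Fin n) → ℕ → Fin n → Set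
Run A f m x = ∀ l → l < m → A (iterate f x l) ≡ true

Run-weaken : ∀ A f {l m} {x : Fin n} → l ≤ m → Run A f m x → Run A f l x
Run-weaken A f l≤m run l' l'<l = run l' (ℕP.<-≤-trans l'<l l≤m)

Run-cons : ∀ A f {m} {x : Fin n} → A x ≡ true → Run A f m (f x) → Run A f (suc m) x
Run-cons A f Ax run zero    _         = Ax
Run-cons A f Ax run (suc l) (s≤s l<m) = run l l<m

iterate-suc : ∀ {X : Set} (f : X → X) x m → iterate f x (suc m) ≡ f (iterate f x m)
iterate-suc f x m = trans (sym (iterate-is-fold x f (suc m))) (cong f (iterate-is-fold x f m))

-- Starting outside B the chain x, f x, f (f x), … never repeats while it stays in A,
-- since f is injective on A with image in B; so after n steps it has left A.
escape : (Fin n → Bool) → (Fin n → Fin n) → ℕ → Fin n → Fin n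
escape A f zero    x = x
escape A f (suc m) x = if A x then escape A f m (f x) else x

escape-reaches : ∀ (A : Fin n → Bool) f m x → ∃ λ l → Run A f l x × escape A f m x ≡ iterate f x l
escape-reaches A f zero    x = 0 , (λ _ ()) , refl
escape-reaches A f (suc m) x with A x in Ax
... | true  = let l , run , reached = escape-reaches A f m (f x) in suc l , Run-cons A f Ax run , reached
... | false = 0 , (λ _ ()) , refl

escape-in-A : ∀ (A : Fin n → Bool) f m x → A (escape A f m x) ≡ true → Run A f (suc m) x
escape-in-A A f zero    x inA = Run-cons A f inA (λ _ ())
escape-in-A A f (suc m) x inA with A x in Ax
... | true  = Run-cons A f Ax (escape-in-A A f m (f x) inA)
... | false = contradiction (trans (sym Ax) inA) λ ()

escape-related : ∀ {R : Fin n → Fin n → Set} (A : Fin n → Bool) f → Reflexive R → Transitive R →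
  (∀ x → A x ≡ true → R (f x) x) → ∀ m x → R (escape A f m x) x
escape-related A f refl′ trans′ step zero    x = refl′
escape-related A f refl′ trans′ step (suc m) x with A x in Ax
... | true  = trans′ (escape-related A f refl′ trans′ step m (f x)) (step x Ax)
... | false = refl′

module _ {n : ℕ} {R : Fin n → Fin n → Set} {A B : Fin n → Bool} {f : Fin n → Fin n}
         (I : Injects R A B f) where

  chain-cancel : ∀ {a b x y} → B x ≡ false → Run A f a x → Run A f b y → a ≤ b →
    iterate f x a ≡ iterate f y b → a ≡ b × x ≡ y
  chain-cancel {zero}  {zero}  _  _     _     _   x≡y = refl , x≡y
  chain-cancel {zero}  {suc b} {x} {y} Bx _ run-y _ x≡fy =
    contradiction (trans (sym Bx) (subst (λ z → B z ≡ true) (sym (trans x≡fy (iterate-suc f y b)))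
                                    (maps-into I _ (run-y b (ℕP.n<1+n b))))) λ ()
  chain-cancel {suc a} {suc b} {x} {y} Bx run-x run-y (s≤s a≤b) eq
    with chain-cancel Bx (Run-weaken A f (n≤1+n a) run-x) (Run-weaken A f (n≤1+n b) run-y) a≤b
           (injective I _ _ (run-x a (ℕP.n<1+n a)) (run-y b (ℕP.n<1+n b))
             (trans (sym (iterate-suc f x a)) (trans eq (iterate-suc f y b))))
  ... | a≡b , x≡y = cong suc a≡b , x≡y

  no-long-run : ∀ {x} → B x ≡ false → ¬ Run A f n x
  no-long-run {x} Bx run with FP.pigeonhole (ℕP.n<1+n n) (λ l → iterate f x (toℕ l))
  ... | l₁ , l₂ , l₁<l₂ , eq =
    <⇒≢ l₁<l₂ (proj₁ (chain-cancel Bx (Run-weaken A f (within l₁) run) (Run-weaken A f (within l₂) run) (<⇒≤ l₁<l₂) eq))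
    where
    within : (l : Fin (suc n)) → toℕ l ≤ n
    within l = s≤s⁻¹ (FP.toℕ<n l)

  escape-leaves-A : ∀ {x} → B x ≡ false → A (escape A f n x) ≡ false
  escape-leaves-A {x} Bx with A (escape A f n x) in inA
  ... | true  = contradiction (Run-weaken A f (n≤1+n n) (escape-in-A A f n x inA)) (no-long-run Bx)
  ... | false = refl

  escape-injective : ∀ {x y} → B x ≡ false → B y ≡ false → escape A f n x ≡ escape A f n y → x ≡ y
  escape-injective {x} {y} Bx By eq with escape-reaches A f n x | escape-reaches A f n y
  ... | a , run-x , ex | b , run-y , ey with ≤-total a b
  ... | inj₁ a≤b = proj₂ (chain-cancel Bx run-x run-y a≤b (trans (sym ex) (trans eq ey)))
  ... | inj₂ b≤a = sym (proj₂ (chain-cancel By run-y run-x b≤a (trans (sym ey) (trans (sym eq) ex))))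

  Injects-complement : Reflexive R → Transitive R →
    Injects R (λ x → not (B x)) (λ x → not (A x)) (escape A f n)
  Injects-complement refl′ trans′ = record
    { maps-into = λ x notBx → ≡false⇒not≡true (escape-leaves-A (not≡true⇒≡false notBx))
    ; injective = λ x y notBx notBy →
        escape-injective (not≡true⇒≡false notBx) (not≡true⇒≡false notBy)
    ; related   = λ x _ → escape-related A f refl′ trans′ (related I) n x
    }

-- Handovers

column : Matrix n → Fin n → Fin n → Bool
column M j i = M i j

-- handover j j' i is the rider of stage j' whose bicycle i takes at the start of stage j.
record Handover (a b : ℚ) {n} (M : Matrix n) : Set where
  field
    handover         : Fin n → Fin n → Fin n → Fin n
    handover-injects : ∀ j j' → toℕ j ≡ suc (toℕ j') →
      Injects (Earlier a b M (toℕ j)) (column M j) (column M j') (handover j j')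

open Handover

module BoolUIP = Decidable⇒UIP BoolP._≟_

-- i itself when j' is not the stage before j or i does not ride stage j.
relayedFrom : ∀ {a b} {M : Matrix n} → Executable a b M k → Fin n → Fin n → Fin n → Fin n
relayedFrom {M = M} (_ , _ , relay) j j' i with toℕ j ℕ.≟ suc (toℕ j') | M i j BoolP.≟ true
... | yes e | yes h = proj₁ (relay j j' e i h)
... | _     | _     = i

relayedFrom-spec : ∀ {a b} {M : Matrix n} (E : Executable a b M k) {j j' i}
  (e : toℕ j ≡ suc (toℕ j')) (h : M i j ≡ true) → relayedFrom E j j' i ≡ proj₁ (proj₂ (proj₂ E) j j' e i h)
relayedFrom-spec {M = M} (_ , _ , relay) {j} {j'} {i} e h with toℕ j ℕ.≟ suc (toℕ j') | M i j BoolP.≟ true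
... | yes e′ | yes h′ = cong₂ (λ e h → proj₁ (relay j j' e i h)) (ℕP.≡-irrelevant e′ e) (BoolUIP.≡-irrelevant h′ h)
... | no ¬e  | _      = contradiction e ¬e
... | yes _  | no ¬h  = contradiction h ¬h

executable⇒handover : ∀ {a b} {M : Matrix n} → Executable a b M k → Handover a b M
executable⇒handover {n = n} {a = a} {b} {M = M} E@(bike , bike-injective , relay) = record
  { handover         = relayedFrom E
  ; handover-injects = λ j j' e → record
    { maps-into = λ i h → subst (λ z → M z j' ≡ true) (sym (relayedFrom-spec E e h)) (rides j j' e i h)
    ; injective = λ i i' h h' same → bike-injective j i i' h h' (begin
        bike i j h                                ≡⟨ sym (same-bike j j' e i h) ⟩
        bike (source j j' e i h) j' (rides j j' e i h)
          ≡⟨ bike-cong (trans (sym (relayedFrom-spec E e h)) (trans same (relayedFrom-spec E e h')))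
                       (rides j j' e i h) (rides j j' e i' h') ⟩
        bike (source j j' e i' h') j' (rides j j' e i' h') ≡⟨ same-bike j j' e i' h' ⟩
        bike i' j h'                              ∎)
    ; related   = λ i h → subst (λ z → Earlier a b M (toℕ j) z i) (sym (relayedFrom-spec E e h))
                                (proj₂ (proj₂ (proj₂ (relay j j' e i h))))
    } }
  where
  open ≡-Reasoning
  source : ∀ j j' e i (h : M i j ≡ true) → Fin n
  source j j' e i h = proj₁ (relay j j' e i h)
  rides : ∀ j j' e i h → M (source j j' e i h) j' ≡ true
  rides j j' e i h = proj₁ (proj₂ (relay j j' e i h))
  same-bike : ∀ j j' e i h → bike (source j j' e i h) j' (rides j j' e i h) ≡ bike i j h
  same-bike j j' e i h = proj₁ (proj₂ (proj₂ (relay j j' e i h)))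
  bike-cong : ∀ {x y j} → x ≡ y → (p : M x j ≡ true) (q : M y j ≡ true) → bike x j p ≡ bike y j q
  bike-cong refl p q = cong (bike _ _) (BoolUIP.≡-irrelevant p q)

toℕ-pred : ∀ {n m} (j : Fin n) → toℕ j ≡ suc m → toℕ (F.pred j) ≡ m
toℕ-pred (F.suc i) e = trans (FP.toℕ-inject₁ i) (ℕP.suc-injective e)

pred-consecutive : ∀ {n m} (j : Fin n) → toℕ j ≡ suc m → toℕ j ≡ suc (toℕ (F.pred j))
pred-consecutive j e = trans e (cong suc (sym (toℕ-pred j e)))

module _ {a b : ℚ} {n : ℕ} {M : Matrix n} (H : Handover a b M) where

  -- A bicycle is named after the first-stage rider it starts with, found by tracing
  -- the handovers back to the first stage; its name is that rider's rank there.
  trace : ℕ → Fin n → Fin n → Fin n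
  trace zero    j i = i
  trace (suc m) j i = trace m (F.pred j) (handover H j (F.pred j) i)

  firstColumn : Fin n → Fin n
  firstColumn j = iterate F.pred j (toℕ j)

  origin : Fin n → Fin n → Fin n
  origin j = trace (toℕ j) j

  private
    step : ∀ {m} j → toℕ j ≡ suc m → Injects (Earlier a b M (toℕ j)) (column M j) (column M (F.pred j)) (handover H j (F.pred j))
    step j e = handover-injects H j (F.pred j) (pred-consecutive j e)

  trace-rides : ∀ m j i → toℕ j ≡ m → M i j ≡ true → M (trace m j i) (iterate F.pred j m) ≡ true
  trace-rides zero    j i _ h = h
  trace-rides (suc m) j i e h = trace-rides m (F.pred j) _ (toℕ-pred j e) (maps-into (step j e) i h)

  trace-injective : ∀ m j i i' → toℕ j ≡ m → M i j ≡ true → M i' j ≡ true → trace m j i ≡ trace m j i' → i ≡ i'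
  trace-injective zero    j i i' _ _ _ same = same
  trace-injective (suc m) j i i' e h h' same = injective (step j e) i i' h h'
    (trace-injective m (F.pred j) _ _ (toℕ-pred j e) (maps-into (step j e) i h) (maps-into (step j e) i' h') same)

  origin-handover : ∀ {j j' i} → toℕ j ≡ suc (toℕ j') →
    firstColumn j ≡ firstColumn j' × origin j i ≡ origin j' (handover H j j' i)
  origin-handover {j} {j'} e rewrite e | FP.toℕ-injective (toℕ-pred j e) = refl , refl

  handover⇒executable : ∀ {k} → (∀ j → count (column M j) ≡ k) → Executable a b M k
  handover⇒executable {k} columns = bike , bike-injective , relay
    where
    origin-rides : ∀ {i j} → M i j ≡ true → column M (firstColumn j) (origin j i) ≡ true
    origin-rides {i} {j} h = trace-rides (toℕ j) j i refl h

    bike : (i j : Fin n) → M i j ≡ true → Fin k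
    bike i j h = fromℕ< (subst (rank (column M (firstColumn j)) (origin j i) <_) (columns (firstColumn j))
                               (rank<count (column M (firstColumn j)) (origin-rides h)))

    bike-injective : ∀ j i i' (h : M i j ≡ true) (h' : M i' j ≡ true) → bike i j h ≡ bike i' j h' → i ≡ i'
    bike-injective j i i' h h' same = trace-injective (toℕ j) j i i' refl h h'
      (rank-injective (column M (firstColumn j)) (origin-rides h) (origin-rides h') (FP.fromℕ<-injective _ _ _ _ same))

    relay : ∀ j j' → toℕ j ≡ suc (toℕ j') → ∀ i (h : M i j ≡ true) →
      Σ (Fin n) λ i' → Σ (M i' j' ≡ true) λ h' → (bike i' j' h' ≡ bike i j h) × Earlier a b M (toℕ j) i' i
    relay j j' e i h = handover H j j' i , maps-into I i h , FP.fromℕ<-cong _ _ same-rank _ _ , related I i h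
      where
      I : Injects (Earlier a b M (toℕ j)) (column M j) (column M j') (handover H j j')
      I = handover-injects H j j' e
      same-rank : rank (column M (firstColumn j')) (origin j' (handover H j j' i)) ≡ rank (column M (firstColumn j)) (origin j i)
      same-rank = sym (cong₂ (λ c x → rank (column M c) x) (proj₁ (origin-handover {i = i} e)) (proj₂ (origin-handover e)))

-- The three symmetries

uniform+handover⇒optimal : ∀ {a b} {M : Matrix n} → Uniform M k → Handover a b M → Optimal a b M
uniform+handover⇒optimal U H = _ , U , handover⇒executable H (proj₂ U)

uniform-permute : {M : Matrix n} (π : Permutation′ n) → Uniform M k → Uniform (λ i j → M (π ⟨$⟩ʳ i) j) k
uniform-permute {M = M} π (rows , columns) =
  (λ i → rows (π ⟨$⟩ʳ i)) , (λ j → trans (count-permute π (column M j)) (columns j))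

handover-permute : ∀ {a b} {M : Matrix n} (π : Permutation′ n) → Handover a b M →
  Handover a b (λ i j → M (π ⟨$⟩ʳ i) j)
handover-permute π H = record
  { handover         = λ j j' i → π ⟨$⟩ˡ handover H j j' (π ⟨$⟩ʳ i)
  ; handover-injects = λ j j' e → Injects-reindex π (handover-injects H j j' e)
  }

uniform-reverse : {M : Matrix n} → Uniform M k → Uniform (λ i j → M i (opposite j)) k
uniform-reverse {M = M} (rows , columns) =
  (λ i → trans (count-permute reverse (M i)) (rows i)) , (λ j → columns (opposite j))

m∸1+n<m : ∀ {m n} → n < m → m ∸ suc n < m
m∸1+n<m {suc m} {n} _ = s≤s (m∸n≤m m n)

[p+q]∸1+t<ᵇp : ∀ p q t → t < p + q → ((p + q) ∸ suc t <ᵇ p) ≡ not (t <ᵇ q)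
[p+q]∸1+t<ᵇp p zero    t       t<p rewrite +-identityʳ p = <⇒<ᵇ≡true (m∸1+n<m t<p)
[p+q]∸1+t<ᵇp p (suc q) zero    _   rewrite +-suc p q = ≮⇒<ᵇ≡false (≤⇒≯ (m≤m+n p q))
[p+q]∸1+t<ᵇp p (suc q) (suc t) t<n rewrite +-suc p q = [p+q]∸1+t<ᵇp p q t (s≤s⁻¹ t<n)

opposite-<ᵇ : ∀ {p q} → p + q ≡ n → (s : Fin n) → (toℕ (opposite s) <ᵇ p) ≡ not (toℕ s <ᵇ q)
opposite-<ᵇ {p = p} {q} p+q≡n s = trans
  (cong (_<ᵇ p) (trans (FP.opposite-prop s) (cong (_∸ suc (toℕ s)) (sym p+q≡n))))
  ([p+q]∸1+t<ᵇp p q (toℕ s) (subst (toℕ s <_) (sym p+q≡n) (FP.toℕ<n s)))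

reversal-cycled : (r : Fin n → Bool) {p q : ℕ} → p + q ≡ n →
  cycledUpTo (λ s → r (opposite s)) p + cycledUpTo r q ≡ count r
reversal-cycled r {p} {q} p+q≡n = begin
  cycledUpTo (λ s → r (opposite s)) p + cycledUpTo r q
    ≡⟨ cong (_+ cycledUpTo r q) reflected ⟩
  count (λ s → not (before s) ∧ r s) + count (λ s → r s ∧ before s)
    ≡⟨ +-comm (count (λ s → not (before s) ∧ r s)) (cycledUpTo r q) ⟩
  count (λ s → r s ∧ before s) + count (λ s → not (before s) ∧ r s)
    ≡⟨ cong (_+ count (λ s → not (before s) ∧ r s)) (count-cong (λ s → ∧-comm (r s) (before s))) ⟩
  count (λ s → before s ∧ r s) + count (λ s → not (before s) ∧ r s)
    ≡⟨ sym (count-partition before r) ⟩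
  count r ∎
  where
  open ≡-Reasoning
  before : Fin _ → Bool
  before s = toℕ s <ᵇ q
  late : Fin _ → Bool
  late s = r s ∧ (toℕ (opposite s) <ᵇ p)
  reflected : cycledUpTo (λ s → r (opposite s)) p ≡ count (λ s → not (before s) ∧ r s)
  reflected = begin
    count (λ s → r (opposite s) ∧ (toℕ s <ᵇ p))
      ≡⟨ count-cong (λ s → cong (λ z → r (opposite s) ∧ (toℕ z <ᵇ p)) (sym (FP.opposite-involutive s))) ⟩
    count (λ s → late (opposite s))
      ≡⟨ count-permute reverse late ⟩
    count late
      ≡⟨ count-cong (λ s → trans (cong (r s ∧_) (opposite-<ᵇ {p = p} {q} p+q≡n s)) (∧-comm (r s) _)) ⟩
    count (λ s → not (before s) ∧ r s) ∎

opposite-after : ∀ {j j' : Fin n} → toℕ j ≡ suc (toℕ j') → toℕ (opposite j') ≡ n ∸ toℕ j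
opposite-after {n} {j} {j'} e = trans (FP.opposite-prop j') (cong (n ∸_) (sym e))

opposite-consecutive : ∀ {j j' : Fin n} → toℕ j ≡ suc (toℕ j') → toℕ (opposite j') ≡ suc (toℕ (opposite j))
opposite-consecutive {n} {j} e =
  trans (opposite-after e) (trans (+-∸-assoc 1 (FP.toℕ<n j)) (cong suc (sym (FP.opposite-prop j))))

handover-reverse : ∀ {a b} {M : Matrix n} → Uniform M k → Handover a b M →
  Handover a b (λ i j → M i (opposite j))
handover-reverse {n} {k} {a} {b} {M} (rows , columns) H = record
  { handover         = λ j j' → preimage (column M (opposite j')) (handover H (opposite j') (opposite j))
  ; handover-injects = λ j j' e →
      Injects-weaken (Earlier-antitone (travelTime a b k n) (λ x → arrivals-reflect j j' e x))
        (Injects-inverse (≤-reflexive (trans (columns (opposite j)) (sym (columns (opposite j')))))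
          (handover-injects H (opposite j') (opposite j) (opposite-consecutive e)))
  }
  where
  arrivals-reflect : ∀ j j' → toℕ j ≡ suc (toℕ j') → ∀ x →
    arrival a b (λ i j → M i (opposite j)) x (toℕ j) +ℚ arrival a b M x (toℕ (opposite j')) ≡ travelTime a b k n
  arrivals-reflect j j' e x = trans
    (arrivals-sum a b {M = λ i j → M i (opposite j)} {M} x x (toℕ j) (toℕ (opposite j'))
      (trans (reversal-cycled (M x) {toℕ j} {toℕ (opposite j')} posts) (rows x)))
    (cong (travelTime a b k) posts)
    where
    posts : toℕ j + toℕ (opposite j') ≡ n
    posts = trans (cong (toℕ j ℕ.+_) (opposite-after e)) (m+[n∸m]≡n (<⇒≤ (FP.toℕ<n j)))

uniform-complement : {M : Matrix n} → Uniform M k → Uniform (λ i j → not (M i j)) (n ∸ k)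
uniform-complement {n} {M = M} (rows , columns) =
  (λ i → trans (count-not (M i)) (cong (n ∸_) (rows i))) ,
  (λ j → trans (count-not (column M j)) (cong (n ∸_) (columns j)))

handover-complement : ∀ {a b} {M : Matrix n} → Uniform M k → Handover a b M →
  Handover a b (λ i j → not (M i j))
handover-complement {n} {k} {a} {b} {M} U H = record
  { handover         = λ j j' → preimage (λ x → not (M x j')) (escape (column M j) (handover H j j') n)
  ; handover-injects = λ j j' e →
      Injects-weaken (Earlier-antitone _ (arrivals-complement (toℕ j)))
        (Injects-inverse (≤-reflexive (trans (proj₂ U′ j) (sym (proj₂ U′ j'))))
          (Injects-complement (handover-injects H j j' e) ℚP.≤-refl ℚP.≤-trans))
  }
  where
  U′ = uniform-complement U
  arrivals-complement : ∀ p x → arrival a b (λ i j → not (M i j)) x p +ℚ arrival a b M x p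
                               ≡ travelTime a b (count {n} (λ s → toℕ s <ᵇ p)) (p + p)
  arrivals-complement p x = arrivals-sum a b {M = λ i j → not (M i j)} {M} x x p p
    (trans (+-comm (cycledUpTo (λ s → not (M x s)) p) (cycledUpTo (M x) p))
           (sym (count-partition (M x) (λ s → toℕ s <ᵇ p))))

theorem3p14 : (a b : ℚ) → 0ℚ <ℚ a → a <ℚ b → (n : ℕ) → (M : Matrix n) →
    Optimal a b M →
      ((π : Permutation′ n) → Optimal a b (λ i j → M (π ⟨$⟩ʳ i) j))
      × Optimal a b (λ i j → M i (opposite j))
      × Optimal a b (λ i j → not (M i j))
theorem3p14 a b _ _ n M (k , U , schedule) =
    (λ π → uniform+handover⇒optimal (uniform-permute π U) (handover-permute π H))
  , uniform+handover⇒optimal (uniform-reverse U) (handover-reverse U H)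
  , uniform+handover⇒optimal (uniform-complement U) (handover-complement U H)
  where
  H : Handover a b M
  H = executable⇒handover schedule
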